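{- Let $V$ be a finite set with $|V|=n$, $f:2^V\to\mathbb{R}_+$ a normalized monotone supermodular function, and $w:V\to\mathbb{R}$. Let $\hat d$ be the output of \textsc{Weighted-SuperGreedy}$(f,w)$, and let $d^*_w$ be the vector produced by Edmonds' greedy algorithm for $w$ (a minimizer of $\langle w,s\rangle$ over $s\in B_f$). Then $$\langle w,\hat d\rangle\le\langle w,d^*_w\rangle+n\sum_{u\in V}f(u\mid V\setminus\{u\})^2.$$ In particular, the additive error does not depend on $w$.
   Context: $f(u\mid A)=f(A\cup\{u\})-f(A)$. $B_f=\{x\ge0: x(S)\ge f(S)\ \forall S\subseteq V,\ x(V)=f(V)\}$ is the base contrapolymatroid. \textsc{Weighted-SuperGreedy}$(f,w)$: set $V'=V$ and $\hat d(u)=0$ for all $u$; repeatedly pick $u\in V'$ minimizing $w(u)+f(V')-f(V'\setminus\{u\})$, set $\hat d(u)=f(V')-f(V'\setminus\{u\})$, and remove $u$ from $V'$, until all elements are removed; return $\hat d$. Edmonds' algorithm: sort $V$ in ascending order of $w$ as $s_1,\dots,s_n$, let $A_i=\{s_i,\dots,s_n\}$, $A_{n+1}=\emptyset$, and set $(d^*_w)_{s_i}=f(A_i)-f(A_{i+1})$.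
   Formalization: The function f takes nonnegative rational values and the weights w are rational, rather than real. -}

module Defs where

open import Data.Nat as ℕ using (ℕ; zero; suc; _≤ᵇ_)
open import Data.Fin as Fin using (Fin; toℕ)
open import Data.Fin.Subset using (Subset; _∈_; _⊆_; _∪_; _∩_; ⊥; ⊤) renaming (_-_ to _∖_)
open import Data.Fin.Permutation using (Permutation′; _⟨$⟩ʳ_; _⟨$⟩ˡ_)
open import Data.Integer using (+_)
open import Data.Rational using (ℚ; 0ℚ; _+_; _-_; _*_; _≤_; _/_)
open import Data.Vec using (tabulate)
open import Relation.Binary.PropositionalEquality using (_≡_)

-- Ground set V = Fin n; set functions f : 2^V → ℚ (values used in place of ℝ).
SetFn : ℕ → Set
SetFn n = Subset n → ℚ

sumFin : (n : ℕ) → (Fin n → ℚ) → ℚ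
sumFin zero    g = 0ℚ
sumFin (suc n) g = g Fin.zero + sumFin n (λ i → g (Fin.suc i))

inner : {n : ℕ} → (Fin n → ℚ) → (Fin n → ℚ) → ℚ
inner {n} x y = sumFin n (λ u → x u * y u)

fromNat : ℕ → ℚ
fromNat k = + k / 1

Normalized : {n : ℕ} → SetFn n → Set
Normalized f = f ⊥ ≡ 0ℚ

NonNegative : {n : ℕ} → SetFn n → Set
NonNegative f = ∀ S → 0ℚ ≤ f S

Monotone : {n : ℕ} → SetFn n → Set
Monotone f = ∀ S T → S ⊆ T → f S ≤ f T

Supermodular : {n : ℕ} → SetFn n → Set
Supermodular f = ∀ S T → f S + f T ≤ f (S ∪ T) + f (S ∩ T)

-- f(S) - f(S \ {u})   (for u ∈ S this is f(u | S \ {u}))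
drop : {n : ℕ} → SetFn n → Subset n → Fin n → ℚ
drop f S u = f S - f (S ∖ u)

-- An ordering of V (σ ⟨$⟩ʳ i is the i-th element, 0-based).
-- suffix σ i = { σ j | j ≥ i }  (the set of elements not yet processed at step i).
suffix : {n : ℕ} → Permutation′ n → ℕ → Subset n
suffix σ i = tabulate (λ u → i ≤ᵇ toℕ (σ ⟨$⟩ˡ u))

orderVector : {n : ℕ} → SetFn n → Permutation′ n → Fin n → ℚ
orderVector f σ u = drop f (suffix σ (toℕ (σ ⟨$⟩ˡ u))) u

-- σ is a valid execution of Weighted-SuperGreedy(f,w): at step i (current set
-- V' = suffix σ i) the removed element σ i minimizes w(u) + f(V') - f(V' \ {u})
-- over u ∈ V' (any tie-breaking allowed). Its output is orderVector f σ.
IsSuperGreedyRun : {n : ℕ} → SetFn n → (Fin n → ℚ) → Permutation′ n → Set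
IsSuperGreedyRun {n} f w σ =
  ∀ (i u : Fin n) → u ∈ suffix σ (toℕ i) →
    w (σ ⟨$⟩ʳ i) + drop f (suffix σ (toℕ i)) (σ ⟨$⟩ʳ i)
      ≤ w u + drop f (suffix σ (toℕ i)) u

-- τ sorts V in ascending order of w (Edmonds' greedy; any tie-breaking).
-- Its output d*_w is orderVector f τ.
IsAscendingOrder : {n : ℕ} → (Fin n → ℚ) → Permutation′ n → Set
IsAscendingOrder {n} w τ = ∀ (i j : Fin n) → toℕ i ℕ.≤ toℕ j → w (τ ⟨$⟩ʳ i) ≤ w (τ ⟨$⟩ʳ j)

{-# OPTIONS --safe #-}

-- Let x be any point of B_f (Edmonds' vector is one) and read everything along the
-- super-greedy order σ: V_k is the set still present before step k, w_k the weight
-- and m_k = f(σ_k | V ∖ σ_k) the marginal of the k-th removed element, so that the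
-- output is d̂_k = f(V_k) − f(V_{k+1}).  The slack e_k = x(V_k) − f(V_k) is
-- nonnegative and vanishes at k = 0 and k = n, so summation by parts gives
--   ⟨w, d̂⟩ − ⟨w, x⟩ = Σ_k w_k (e_{k+1} − e_k) = Σ_k e_{k+1} (w_k − w_{k+1}).
-- Supermodularity makes marginals grow with the set, so the greedy choice at step k
-- forces w_k − w_{k+1} ≤ m_{k+1}, and e_k ≤ f(V) − f(V_k) ≤ Σ_j m_j =: E.  Hence the
-- error is at most E², and E² ≤ n Σ_j m_j² by Cauchy–Schwarz.

module Submission where

open import Algebra.Bundles using (CommutativeMonoid)
import Algebra.Properties.CommutativeMonoid.Sum as CommutativeMonoidSum
open import Data.Bool using (true; false; if_then_else_)
open import Data.Bool.Properties using (T-≡)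
open import Data.Fin as Fin using (Fin; zero; suc; toℕ; fromℕ<)
open import Data.Fin.Permutation using (Permutation′; _⟨$⟩ʳ_; _⟨$⟩ˡ_; inverseˡ; inverseʳ)
open import Data.Fin.Properties using (toℕ<n; toℕ-injective; toℕ-fromℕ<)
open import Data.Fin.Subset using (Subset; _∈_; _∉_; _⊆_; _∪_; _∩_; ⊤; ⊥; ⁅_⁆) renaming (_-_ to _∖_)
open import Data.Fin.Subset.Properties
  using (⊆-antisym; ⊆⊤; ⊥⊆; x∈p∪q⁺; x∈p∪q⁻; x∈p∩q⁺; x∈p∩q⁻; p∩q⊆p; p─q⊆p; x∈p∧x≢y⇒x∈p-y; _∈?_;
         ∩-identityˡ; ∩-zeroˡ)
import Data.Integer as ℤ
import Data.Integer.Properties as ℤ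
open import Data.Nat as ℕ using (ℕ; zero; suc; z≤n; s≤s; _≤ᵇ_)
import Data.Nat.Properties as ℕ
open import Data.Nat.Coprimality using (1-coprimeTo) renaming (sym to coprime-sym)
open import Data.Product using (_,_; proj₂)
open import Data.Rational using (ℚ; 0ℚ; 1ℚ; mkℚ; _+_; _-_; -_; _*_; _≤_; toℚᵘ; nonNegative; nonPositive)
open import Data.Rational.Properties
import Data.Rational.Unnormalised as ℚᵘ
import Data.Rational.Unnormalised.Properties as ℚᵘ
open import Data.Sum using (inj₁; inj₂)
open import Data.Vec using (_∷_; there)
open import Data.Vec.Properties using (lookup∘tabulate; lookup⇒[]=; []=⇒lookup)
open import Function using (_∘_)
open import Function.Bundles using (_⇔_; mk⇔; Equivalence)
open import Level using (0ℓ)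
open import Relation.Binary.PropositionalEquality
open import Relation.Nullary using (yes; no; contradiction)
open import Relation.Nullary.Decidable using (does; does-⇔; dec⇒maybe)
open import Tactic.RingSolver using (solve-∀)
open import Tactic.RingSolver.Core.AlmostCommutativeRing using (AlmostCommutativeRing; fromCommutativeRing)

open import Defs

open import Algebra.Properties.CommutativeSemigroup
  (CommutativeMonoid.commutativeSemigroup +-0-commutativeMonoid)
  using () renaming (interchange to +-interchange)

ℚ-ring : AlmostCommutativeRing 0ℓ 0ℓ
ℚ-ring = fromCommutativeRing +-*-commutativeRing (λ p → dec⇒maybe (0ℚ ≟ p))

fromNat-suc : ∀ k → fromNat (suc k) ≡ 1ℚ + fromNat k
fromNat-suc k = toℚᵘ-injective (ℚᵘ.≃-trans step (ℚᵘ.≃-sym (toℚᵘ-homo-+ 1ℚ (fromNat k))))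
  where
  fromNat≡mkℚ : ∀ j → fromNat j ≡ mkℚ (ℤ.+ j) 0 (coprime-sym (1-coprimeTo j))
  fromNat≡mkℚ j = normalize-coprime (coprime-sym (1-coprimeTo j))
  step : toℚᵘ (fromNat (suc k)) ℚᵘ.≃ toℚᵘ 1ℚ ℚᵘ.+ toℚᵘ (fromNat k)
  step rewrite fromNat≡mkℚ k | fromNat≡mkℚ (suc k) | ℕ.*-identityʳ k | ℤ.+◃n≡+n k = ℚᵘ.*≡* refl

p≤q⇒0≤q-p : ∀ {p q} → p ≤ q → 0ℚ ≤ q - p
p≤q⇒0≤q-p {p} {q} p≤q = begin
  0ℚ    ≡⟨ +-inverseʳ p ⟨
  p - p ≤⟨ +-monoˡ-≤ (- p) p≤q ⟩
  q - p ∎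
  where open ≤-Reasoning

0≤q-p⇒p≤q : ∀ {p q} → 0ℚ ≤ q - p → p ≤ q
0≤q-p⇒p≤q {p} {q} 0≤q-p = begin
  p            ≡⟨ +-identityˡ p ⟨
  0ℚ + p       ≤⟨ +-monoˡ-≤ p 0≤q-p ⟩
  (q - p) + p  ≡⟨ cancel q p ⟩
  q            ∎
  where
  open ≤-Reasoning
  cancel : ∀ q p → (q - p) + p ≡ q
  cancel = solve-∀ ℚ-ring

p-q≤p : ∀ p {q} → 0ℚ ≤ q → p - q ≤ p
p-q≤p p {q} 0≤q = begin
  p - q   ≤⟨ +-monoʳ-≤ p (neg-antimono-≤ 0≤q) ⟩
  p - 0ℚ  ≡⟨ +-identityʳ p ⟩
  p       ∎
  where open ≤-Reasoning

p+q≤r+s⇒p-s≤r-q : ∀ {p q r s} → p + q ≤ r + s → p - s ≤ r - q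
p+q≤r+s⇒p-s≤r-q {p} {q} {r} {s} le = begin
  p - s              ≡⟨ cancel p s q ⟨
  (p + q) - (q + s)  ≤⟨ +-monoˡ-≤ (- (q + s)) le ⟩
  (r + s) - (q + s)  ≡⟨ trans (cong (λ t → (r + s) - t) (+-comm q s)) (cancel r q s) ⟩
  r - q              ∎
  where
  open ≤-Reasoning
  cancel : ∀ a b c → (a + c) - (c + b) ≡ a - b
  cancel = solve-∀ ℚ-ring

0≤p+q : ∀ {p q} → 0ℚ ≤ p → 0ℚ ≤ q → 0ℚ ≤ p + q
0≤p+q {p} {q} 0≤p 0≤q = nonNegative⁻¹ _
  {{nonNeg+nonNeg⇒nonNeg p {{nonNegative 0≤p}} q {{nonNegative 0≤q}}}}

0≤p*q : ∀ {p q} → 0ℚ ≤ p → 0ℚ ≤ q → 0ℚ ≤ p * q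
0≤p*q {p} {q} 0≤p 0≤q = nonNegative⁻¹ _
  {{nonNeg*nonNeg⇒nonNeg p {{nonNegative 0≤p}} q {{nonNegative 0≤q}}}}

-- Despite its name, the library's nonPos*nonPos⇒nonPos concludes NonNegative.
0≤p*p : ∀ p → 0ℚ ≤ p * p
0≤p*p p with ≤-total 0ℚ p
... | inj₁ 0≤p = 0≤p*q 0≤p 0≤p
... | inj₂ p≤0 = nonNegative⁻¹ _ {{nonPos*nonPos⇒nonPos p {{nonPositive p≤0}} p {{nonPositive p≤0}}}}

p+p*q≤p*p+q*q : ∀ p q → (p + p) * q ≤ p * p + q * q
p+p*q≤p*p+q*q p q = 0≤q-p⇒p≤q (subst (0ℚ ≤_) (square-gap p q) (0≤p*p (p - q)))
  where
  square-gap : ∀ p q → (p - q) * (p - q) ≡ (p * p + q * q) - (p + p) * q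
  square-gap = solve-∀ ℚ-ring

sumFin-cong : ∀ n {g h : Fin n → ℚ} → (∀ i → g i ≡ h i) → sumFin n g ≡ sumFin n h
sumFin-cong zero    g≗h = refl
sumFin-cong (suc n) g≗h = cong₂ _+_ (g≗h zero) (sumFin-cong n (g≗h ∘ suc))

sumFin-mono : ∀ n {g h : Fin n → ℚ} → (∀ i → g i ≤ h i) → sumFin n g ≤ sumFin n h
sumFin-mono zero    g≤h = ≤-refl
sumFin-mono (suc n) g≤h = +-mono-≤ (g≤h zero) (sumFin-mono n (g≤h ∘ suc))

sumFin-nonneg : ∀ n {g : Fin n → ℚ} → (∀ i → 0ℚ ≤ g i) → 0ℚ ≤ sumFin n g
sumFin-nonneg zero    0≤g = ≤-refl
sumFin-nonneg (suc n) 0≤g = 0≤p+q (0≤g zero) (sumFin-nonneg n (0≤g ∘ suc))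

sumFin-+ : ∀ n (g h : Fin n → ℚ) → sumFin n (λ i → g i + h i) ≡ sumFin n g + sumFin n h
sumFin-+ zero    g h = sym (+-identityʳ 0ℚ)
sumFin-+ (suc n) g h =
  trans (cong ((g zero + h zero) +_) (sumFin-+ n (g ∘ suc) (h ∘ suc)))
    (+-interchange (g zero) (h zero) (sumFin n (g ∘ suc)) (sumFin n (h ∘ suc)))

sumFin-*ˡ : ∀ n c (g : Fin n → ℚ) → sumFin n (λ i → c * g i) ≡ c * sumFin n g
sumFin-*ˡ zero    c g = sym (*-zeroʳ c)
sumFin-*ˡ (suc n) c g = trans (cong ((c * g zero) +_) (sumFin-*ˡ n c (g ∘ suc))) (sym (*-distribˡ-+ c _ _))

sumFin-permute : ∀ n (g : Fin n → ℚ) (π : Permutation′ n) → sumFin n g ≡ sumFin n (λ i → g (π ⟨$⟩ʳ i))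
sumFin-permute n g π = trans (sumFin≡sum n g) (trans (sum-permute g π) (sym (sumFin≡sum n _)))
  where
  open CommutativeMonoidSum +-0-commutativeMonoid using (sum; sum-permute)
  sumFin≡sum : ∀ n (g : Fin n → ℚ) → sumFin n g ≡ sum g
  sumFin≡sum zero    g = refl
  sumFin≡sum (suc n) g = cong (g zero +_) (sumFin≡sum n (g ∘ suc))

sumBelow : ℕ → (ℕ → ℚ) → ℚ
sumBelow N h = sumFin N (λ i → h (toℕ i))

sumBelow-telescope : ∀ N (b : ℕ → ℚ) → sumBelow N (λ k → b k - b (suc k)) ≡ b 0 - b N
sumBelow-telescope zero    b = sym (+-inverseʳ (b 0))
sumBelow-telescope (suc N) b = begin
  (b 0 - b 1) + sumBelow N (λ k → b (suc k) - b (suc (suc k))) ≡⟨ cong ((b 0 - b 1) +_) (sumBelow-telescope N (b ∘ suc)) ⟩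
  (b 0 - b 1) + (b 1 - b (suc N))                               ≡⟨ cancel (b 0) (b 1) (b (suc N)) ⟩
  b 0 - b (suc N)                                               ∎
  where
  open ≡-Reasoning
  cancel : ∀ p q r → (p - q) + (q - r) ≡ p - r
  cancel = solve-∀ ℚ-ring

sumBelow-snoc : ∀ N (h : ℕ → ℚ) → sumBelow (suc N) h ≡ sumBelow N h + h N
sumBelow-snoc zero    h = +-comm (h 0) 0ℚ
sumBelow-snoc (suc N) h = trans (cong (h 0 +_) (sumBelow-snoc N (h ∘ suc))) (sym (+-assoc (h 0) _ _))

sumBelow-monoˡ-≤ : ∀ {h : ℕ → ℚ} → (∀ j → 0ℚ ≤ h j) → ∀ {k N} → k ℕ.≤ N → sumBelow k h ≤ sumBelow N h
sumBelow-monoˡ-≤ 0≤h {N = N} z≤n = sumFin-nonneg N (0≤h ∘ toℕ)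
sumBelow-monoˡ-≤ {h} 0≤h (s≤s k≤N) = +-monoʳ-≤ (h 0) (sumBelow-monoˡ-≤ (0≤h ∘ suc) k≤N)

tailSum : ℕ → (ℕ → ℚ) → ℕ → ℚ
tailSum N x k = sumBelow N (λ j → if k ≤ᵇ j then x j else 0ℚ)

-- The split on k is what lets suc k ≤ᵇ suc j reduce to k ≤ᵇ j.
tailSum-shift : ∀ N x k → tailSum (suc N) x (suc k) ≡ tailSum N (x ∘ suc) k
tailSum-shift N x zero    = +-identityˡ _
tailSum-shift N x (suc k) = +-identityˡ _

tailSum-suc : ∀ N x k → k ℕ.< N → tailSum N x k ≡ x k + tailSum N x (suc k)
tailSum-suc (suc N) x zero    _ = cong (x 0 +_) (sym (tailSum-shift N x 0))
tailSum-suc (suc N) x (suc k) (s≤s k<N) = begin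
  tailSum (suc N) x (suc k)                  ≡⟨ tailSum-shift N x k ⟩
  tailSum N (x ∘ suc) k                      ≡⟨ tailSum-suc N (x ∘ suc) k k<N ⟩
  x (suc k) + tailSum N (x ∘ suc) (suc k)    ≡⟨ cong (x (suc k) +_) (tailSum-shift N x (suc k)) ⟨
  x (suc k) + tailSum (suc N) x (suc (suc k)) ∎
  where open ≡-Reasoning

tailSum-beyond : ∀ N x k → N ℕ.≤ k → tailSum N x k ≡ 0ℚ
tailSum-beyond zero    x k       _         = refl
tailSum-beyond (suc N) x (suc k) (s≤s N≤k) = trans (tailSum-shift N x k) (tailSum-beyond N (x ∘ suc) k N≤k)

tailSum≤sumBelow : ∀ N {x} → (∀ j → 0ℚ ≤ x j) → ∀ k → tailSum N x k ≤ sumBelow N x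
tailSum≤sumBelow N {x} 0≤x k = sumFin-mono N (λ i → term≤ (toℕ i))
  where
  term≤ : ∀ j → (if k ≤ᵇ j then x j else 0ℚ) ≤ x j
  term≤ j with k ≤ᵇ j
  ... | true  = ≤-refl
  ... | false = 0≤x j

sumFin-cross-term≤ : ∀ n a (y : Fin n → ℚ) →
  (a + a) * sumFin n y ≤ fromNat n * (a * a) + sumFin n (λ i → y i * y i)
sumFin-cross-term≤ zero    a y = ≤-reflexive (trans (*-zeroʳ (a + a)) (sym (trans (+-identityʳ _) (*-zeroˡ (a * a)))))
sumFin-cross-term≤ (suc n) a y = begin
  (a + a) * (b + S)                              ≡⟨ *-distribˡ-+ (a + a) b S ⟩
  (a + a) * b + (a + a) * S                      ≤⟨ +-mono-≤ (p+p*q≤p*p+q*q a b) (sumFin-cross-term≤ n a (y ∘ suc)) ⟩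
  (a * a + b * b) + (fromNat n * (a * a) + Q)    ≡⟨ regroup a b (fromNat n) Q ⟩
  (1ℚ + fromNat n) * (a * a) + (b * b + Q)       ≡⟨ cong (λ c → c * (a * a) + (b * b + Q)) (fromNat-suc n) ⟨
  fromNat (suc n) * (a * a) + (b * b + Q)        ∎
  where
  open ≤-Reasoning
  b = y zero
  S = sumFin n (y ∘ suc)
  Q = sumFin n (λ i → y (suc i) * y (suc i))
  regroup : ∀ a b c q → (a * a + b * b) + (c * (a * a) + q) ≡ (1ℚ + c) * (a * a) + (b * b + q)
  regroup = solve-∀ ℚ-ring

cauchy-schwarz : ∀ n (g : Fin n → ℚ) → sumFin n g * sumFin n g ≤ fromNat n * sumFin n (λ i → g i * g i)
cauchy-schwarz zero    g = ≤-refl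
cauchy-schwarz (suc n) g = begin
  (a + S) * (a + S)                                  ≡⟨ expand a S ⟩
  a * a + (a + a) * S + S * S                        ≤⟨ +-mono-≤ (+-monoʳ-≤ (a * a) (sumFin-cross-term≤ n a (g ∘ suc)))
                                                                 (cauchy-schwarz n (g ∘ suc)) ⟩
  a * a + (fromNat n * (a * a) + Q) + fromNat n * Q  ≡⟨ regroup (a * a) (fromNat n) Q ⟩
  (1ℚ + fromNat n) * (a * a + Q)                     ≡⟨ cong (_* (a * a + Q)) (fromNat-suc n) ⟨
  fromNat (suc n) * (a * a + Q)                      ∎
  where
  open ≤-Reasoning
  a = g zero
  S = sumFin n (g ∘ suc)
  Q = sumFin n (λ i → g (suc i) * g (suc i))
  expand : ∀ a s → (a + s) * (a + s) ≡ a * a + (a + a) * s + s * s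
  expand = solve-∀ ℚ-ring
  regroup : ∀ a² c q → a² + (c * a² + q) + c * q ≡ (1ℚ + c) * (a² + q)
  regroup = solve-∀ ℚ-ring

sumBelow-by-parts : ∀ N (w e : ℕ → ℚ) →
  sumBelow N (λ k → w k * (e (suc k) - e k)) + w 0 * e 0
    ≡ sumBelow N (λ k → e (suc k) * (w k - w (suc k))) + w N * e N
sumBelow-by-parts zero    w e = refl
sumBelow-by-parts (suc N) w e = begin
  (w 0 * (e 1 - e 0) + S) + w 0 * e 0                ≡⟨ regroup (w 0) (w 1) (e 0) (e 1) S ⟩
  e 1 * (w 0 - w 1) + (S + w 1 * e 1)                ≡⟨ cong (e 1 * (w 0 - w 1) +_) (sumBelow-by-parts N (w ∘ suc) (e ∘ suc)) ⟩
  e 1 * (w 0 - w 1) + (T + w (suc N) * e (suc N))    ≡⟨ +-assoc (e 1 * (w 0 - w 1)) T (w (suc N) * e (suc N)) ⟨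
  (e 1 * (w 0 - w 1) + T) + w (suc N) * e (suc N)    ∎
  where
  open ≡-Reasoning
  S = sumBelow N (λ k → w (suc k) * (e (suc (suc k)) - e (suc k)))
  T = sumBelow N (λ k → e (suc (suc k)) * (w (suc k) - w (suc (suc k))))
  regroup : ∀ w₀ w₁ e₀ e₁ s → (w₀ * (e₁ - e₀) + s) + w₀ * e₀ ≡ e₁ * (w₀ - w₁) + (s + w₁ * e₁)
  regroup = solve-∀ ℚ-ring

zeroExtend : ∀ {n} → (Fin n → ℚ) → ℕ → ℚ
zeroExtend {zero}  g k       = 0ℚ
zeroExtend {suc n} g zero    = g zero
zeroExtend {suc n} g (suc k) = zeroExtend (g ∘ suc) k

zeroExtend-toℕ : ∀ {n} (g : Fin n → ℚ) i → zeroExtend g (toℕ i) ≡ g i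
zeroExtend-toℕ g zero    = refl
zeroExtend-toℕ g (suc i) = zeroExtend-toℕ (g ∘ suc) i

zeroExtend-fromℕ< : ∀ {n} (g : Fin n → ℚ) {k} (k<n : k ℕ.< n) → zeroExtend g k ≡ g (fromℕ< k<n)
zeroExtend-fromℕ< g k<n = trans (cong (zeroExtend g) (sym (toℕ-fromℕ< k<n))) (zeroExtend-toℕ g _)

zeroExtend-beyond : ∀ {n} (g : Fin n → ℚ) {k} → n ℕ.≤ k → zeroExtend g k ≡ 0ℚ
zeroExtend-beyond {zero}  g _         = refl
zeroExtend-beyond {suc n} g (s≤s n≤k) = zeroExtend-beyond (g ∘ suc) n≤k

zeroExtend-nonneg : ∀ {n} {g : Fin n → ℚ} → (∀ i → 0ℚ ≤ g i) → ∀ k → 0ℚ ≤ zeroExtend g k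
zeroExtend-nonneg {zero}            0≤g k       = ≤-refl
zeroExtend-nonneg {suc n}           0≤g zero    = 0≤g zero
zeroExtend-nonneg {suc n} {g = g}   0≤g (suc k) = zeroExtend-nonneg {g = g ∘ suc} (0≤g ∘ suc) k

sumFin-reindex : ∀ {n} (π : Permutation′ n) {g : Fin n → ℚ} (h : ℕ → ℚ) →
                 (∀ i → h (toℕ i) ≡ g (π ⟨$⟩ʳ i)) → sumFin n g ≡ sumBelow n h
sumFin-reindex {n} π {g} h h≗g∘π = trans (sumFin-permute n g π) (sumFin-cong n (sym ∘ h≗g∘π))

inner-reindex : ∀ {n} (π : Permutation′ n) (g h : Fin n → ℚ) →
                inner g h ≡ sumBelow n (λ k → zeroExtend (g ∘ (π ⟨$⟩ʳ_)) k * zeroExtend (h ∘ (π ⟨$⟩ʳ_)) k)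
inner-reindex π g h = sumFin-reindex π (λ k → G k * H k) (λ i → cong₂ _*_ (zeroExtend-toℕ _ i) (zeroExtend-toℕ _ i))
  where
  G = zeroExtend (g ∘ (π ⟨$⟩ʳ_))
  H = zeroExtend (h ∘ (π ⟨$⟩ʳ_))

-- The inequality for sequences

module _ (N : ℕ) (w a x m : ℕ → ℚ)
         (a≤tailSum : ∀ k → a k ≤ tailSum N x k)
         (sumBelow-x : sumBelow N x ≡ a 0)
         (a-end : a N ≡ 0ℚ)
         (x-nonneg : ∀ j → 0ℚ ≤ x j)
         (m-nonneg : ∀ j → 0ℚ ≤ m j)
         (m-end : m N ≡ 0ℚ)
         (a-steps : ∀ j → j ℕ.< N → a j - a (suc j) ≤ m j)
         (w-steps : ∀ k → suc k ℕ.< N → w k - w (suc k) ≤ m (suc k))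
  where

  private
    E : ℚ
    E = sumBelow N m

    0≤E : 0ℚ ≤ E
    0≤E = sumFin-nonneg N (m-nonneg ∘ toℕ)

    slack : ℕ → ℚ
    slack k = tailSum N x k - a k

    slack-start : slack 0 ≡ 0ℚ
    slack-start = trans (cong (_- a 0) sumBelow-x) (+-inverseʳ (a 0))

    slack-end : slack N ≡ 0ℚ
    slack-end = cong₂ _-_ (tailSum-beyond N x N ℕ.≤-refl) a-end

    slack-nonneg : ∀ k → 0ℚ ≤ slack k
    slack-nonneg k = p≤q⇒0≤q-p (a≤tailSum k)

    slack≤E : ∀ k → k ℕ.≤ N → slack k ≤ E
    slack≤E k k≤N = begin
      tailSum N x k - a k                   ≤⟨ +-monoˡ-≤ (- a k) (tailSum≤sumBelow N x-nonneg k) ⟩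
      sumBelow N x - a k                    ≡⟨ cong (_- a k) sumBelow-x ⟩
      a 0 - a k                             ≡⟨ sumBelow-telescope k a ⟨
      sumBelow k (λ j → a j - a (suc j))    ≤⟨ sumFin-mono k (λ i → a-steps (toℕ i) (ℕ.<-≤-trans (toℕ<n i) k≤N)) ⟩
      sumBelow k m                          ≤⟨ sumBelow-monoˡ-≤ m-nonneg k≤N ⟩
      E                                     ∎
      where open ≤-Reasoning

    step-split : ∀ k → k ℕ.< N → w k * (a k - a (suc k)) ≡ w k * x k + w k * (slack (suc k) - slack k)
    step-split k k<N = begin
      w k * (a k - a (suc k))
        ≡⟨ regroup (w k) (a k) (a (suc k)) (x k) (tailSum N x (suc k)) ⟩
      w k * x k + w k * (slack (suc k) - (x k + tailSum N x (suc k) - a k))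
        ≡⟨ cong (λ t → w k * x k + w k * (slack (suc k) - (t - a k))) (tailSum-suc N x k k<N) ⟨
      w k * x k + w k * (slack (suc k) - slack k)
        ∎
      where
      open ≡-Reasoning
      regroup : ∀ w a a′ x t′ → w * (a - a′) ≡ w * x + w * ((t′ - a′) - (x + t′ - a))
      regroup = solve-∀ ℚ-ring

    slack-by-parts : sumBelow N (λ k → w k * (slack (suc k) - slack k))
                     ≡ sumBelow N (λ k → slack (suc k) * (w k - w (suc k)))
    slack-by-parts = begin
      L                  ≡⟨ +-identityʳ L ⟨
      L + 0ℚ             ≡⟨ cong (L +_) (vanishes 0 slack-start) ⟨
      L + w 0 * slack 0  ≡⟨ sumBelow-by-parts N w slack ⟩
      R + w N * slack N  ≡⟨ cong (R +_) (vanishes N slack-end) ⟩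
      R + 0ℚ             ≡⟨ +-identityʳ R ⟩
      R                  ∎
      where
      open ≡-Reasoning
      L = sumBelow N (λ k → w k * (slack (suc k) - slack k))
      R = sumBelow N (λ k → slack (suc k) * (w k - w (suc k)))
      vanishes : ∀ k → slack k ≡ 0ℚ → w k * slack k ≡ 0ℚ
      vanishes k eq = trans (cong (w k *_) eq) (*-zeroʳ (w k))

    slack-weight≤ : ∀ k → k ℕ.< N → slack (suc k) * (w k - w (suc k)) ≤ E * m (suc k)
    slack-weight≤ k k<N with ℕ.m≤n⇒m<n∨m≡n k<N
    ... | inj₁ 1+k<N = begin
      slack (suc k) * (w k - w (suc k))  ≤⟨ *-monoˡ-≤-nonNeg (slack (suc k)) {{nonNegative (slack-nonneg (suc k))}} (w-steps k 1+k<N) ⟩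
      slack (suc k) * m (suc k)          ≤⟨ *-monoʳ-≤-nonNeg (m (suc k)) {{nonNegative (m-nonneg (suc k))}} (slack≤E (suc k) k<N) ⟩
      E * m (suc k)                      ∎
      where open ≤-Reasoning
    ... | inj₂ 1+k≡N = begin
      slack (suc k) * (w k - w (suc k))  ≡⟨ cong (λ s → s * (w k - w (suc k))) (trans (cong slack 1+k≡N) slack-end) ⟩
      0ℚ * (w k - w (suc k))             ≡⟨ *-zeroˡ (w k - w (suc k)) ⟩
      0ℚ                                 ≤⟨ 0≤p*q 0≤E (m-nonneg (suc k)) ⟩
      E * m (suc k)                      ∎
      where open ≤-Reasoning

    shifted-m≤E : sumBelow N (m ∘ suc) ≤ E
    shifted-m≤E = begin
      sumBelow N (m ∘ suc)          ≤⟨ ≤-trans (≤-reflexive (sym (+-identityˡ _))) (+-monoˡ-≤ _ (m-nonneg 0)) ⟩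
      m 0 + sumBelow N (m ∘ suc)    ≡⟨ sumBelow-snoc N m ⟩
      E + m N                       ≡⟨ trans (cong (E +_) m-end) (+-identityʳ E) ⟩
      E                             ∎
      where open ≤-Reasoning

  weighted-decrements≤ : sumBelow N (λ k → w k * (a k - a (suc k)))
                         ≤ sumBelow N (λ k → w k * x k) + fromNat N * sumBelow N (λ k → m k * m k)
  weighted-decrements≤ = begin
    sumBelow N (λ k → w k * (a k - a (suc k)))
      ≡⟨ sumFin-cong N (λ i → step-split (toℕ i) (toℕ<n i)) ⟩
    sumBelow N (λ k → w k * x k + w k * (slack (suc k) - slack k))
      ≡⟨ sumFin-+ N _ _ ⟩
    Σwx + sumBelow N (λ k → w k * (slack (suc k) - slack k))
      ≡⟨ cong (Σwx +_) slack-by-parts ⟩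
    Σwx + sumBelow N (λ k → slack (suc k) * (w k - w (suc k)))
      ≤⟨ +-monoʳ-≤ Σwx (sumFin-mono N (λ i → slack-weight≤ (toℕ i) (toℕ<n i))) ⟩
    Σwx + sumBelow N (λ k → E * m (suc k))
      ≡⟨ cong (Σwx +_) (sumFin-*ˡ N E _) ⟩
    Σwx + E * sumBelow N (m ∘ suc)
      ≤⟨ +-monoʳ-≤ Σwx (*-monoˡ-≤-nonNeg E {{nonNegative 0≤E}} shifted-m≤E) ⟩
    Σwx + E * E
      ≤⟨ +-monoʳ-≤ Σwx (cauchy-schwarz N (m ∘ toℕ)) ⟩
    Σwx + fromNat N * sumBelow N (λ k → m k * m k)
      ∎
    where
    open ≤-Reasoning
    Σwx = sumBelow N (λ k → w k * x k)

x∉p-x : ∀ {n} (p : Subset n) x → x ∉ p ∖ x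
x∉p-x (_ ∷ p) zero    ()
x∉p-x (_ ∷ p) (suc x) (there x∈p-x) = x∉p-x p x x∈p-x

x∈p-y⇒x≢y : ∀ {n} {p : Subset n} {x y} → x ∈ p ∖ y → x ≢ y
x∈p-y⇒x≢y {p = p} x∈p-x refl = x∉p-x p _ x∈p-x

x∉p⇒p-x≡p : ∀ {n} {p : Subset n} {x} → x ∉ p → p ∖ x ≡ p
x∉p⇒p-x≡p {p = p} {x} x∉p = ⊆-antisym (p─q⊆p p ⁅ x ⁆) p⊆p-x
  where
  p⊆p-x : p ⊆ p ∖ x
  p⊆p-x y∈p = x∈p∧x≢y⇒x∈p-y y∈p (λ { refl → x∉p y∈p })

p-x∩q≡p∩q-x : ∀ {n} (p q : Subset n) x → (p ∖ x) ∩ q ≡ (p ∩ q) ∖ x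
p-x∩q≡p∩q-x p q x = ⊆-antisym to from
  where
  to : (p ∖ x) ∩ q ⊆ (p ∩ q) ∖ x
  to y∈ with x∈p∩q⁻ (p ∖ x) q y∈
  ... | y∈p-x , y∈q = x∈p∧x≢y⇒x∈p-y (x∈p∩q⁺ (p─q⊆p p ⁅ x ⁆ y∈p-x , y∈q)) (x∈p-y⇒x≢y y∈p-x)
  from : (p ∩ q) ∖ x ⊆ (p ∖ x) ∩ q
  from y∈ with x∈p∩q⁻ p q (p─q⊆p (p ∩ q) ⁅ x ⁆ y∈)
  ... | y∈p , y∈q = x∈p∩q⁺ (x∈p∧x≢y⇒x∈p-y y∈p (x∈p-y⇒x≢y y∈) , y∈q)

p⊆q∧x∈p⇒p∪q-x≡q : ∀ {n} {p q : Subset n} {x} → p ⊆ q → x ∈ p → p ∪ (q ∖ x) ≡ q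
p⊆q∧x∈p⇒p∪q-x≡q {p = p} {q} {x} p⊆q x∈p = ⊆-antisym to from
  where
  to : p ∪ (q ∖ x) ⊆ q
  to y∈ with x∈p∪q⁻ p (q ∖ x) y∈
  ... | inj₁ y∈p   = p⊆q y∈p
  ... | inj₂ y∈q-x = p─q⊆p q ⁅ x ⁆ y∈q-x
  from : q ⊆ p ∪ (q ∖ x)
  from {y} y∈q with y Fin.≟ x
  ... | yes refl = x∈p∪q⁺ (inj₁ x∈p)
  ... | no  y≢x  = x∈p∪q⁺ (inj₂ (x∈p∧x≢y⇒x∈p-y y∈q y≢x))

p⊆q⇒p∩q-x≡p-x : ∀ {n} {p q : Subset n} {x} → p ⊆ q → p ∩ (q ∖ x) ≡ p ∖ x
p⊆q⇒p∩q-x≡p-x {p = p} {q} {x} p⊆q = ⊆-antisym to from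
  where
  to : p ∩ (q ∖ x) ⊆ p ∖ x
  to y∈ with x∈p∩q⁻ p (q ∖ x) y∈
  ... | y∈p , y∈q-x = x∈p∧x≢y⇒x∈p-y y∈p (x∈p-y⇒x≢y y∈q-x)
  from : p ∖ x ⊆ p ∩ (q ∖ x)
  from y∈p-x = x∈p∩q⁺ (y∈p , x∈p∧x≢y⇒x∈p-y (p⊆q y∈p) (x∈p-y⇒x≢y y∈p-x))
    where y∈p = p─q⊆p p ⁅ x ⁆ y∈p-x

module _ {n} (f : SetFn n) where

  drop-nonneg : Monotone f → ∀ S u → 0ℚ ≤ drop f S u
  drop-nonneg monotone S u = p≤q⇒0≤q-p (monotone (S ∖ u) S (p─q⊆p S ⁅ u ⁆))

  drop-∉ : ∀ {S u} → u ∉ S → drop f S u ≡ 0ℚ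
  drop-∉ {S} u∉S = trans (cong (λ T → f S - f T) (x∉p⇒p-x≡p u∉S)) (+-inverseʳ (f S))

  drop-mono : Supermodular f → ∀ {A B u} → A ⊆ B → u ∈ A → drop f A u ≤ drop f B u
  drop-mono supermodular {A} {B} {u} A⊆B u∈A = p+q≤r+s⇒p-s≤r-q {f A} {f (B ∖ u)} {f B} {f (A ∖ u)}
    (subst₂ (λ C D → f A + f (B ∖ u) ≤ f C + f D)
            (p⊆q∧x∈p⇒p∪q-x≡q A⊆B u∈A) (p⊆q⇒p∩q-x≡p-x A⊆B) (supermodular A (B ∖ u)))

  drop-∩≤ : Supermodular f → ∀ {T} S {u} → u ∈ T →
            drop f (T ∩ S) u ≤ (if does (u ∈? S) then drop f T u else 0ℚ)
  drop-∩≤ supermodular {T} S {u} u∈T with u ∈? S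
  ... | yes u∈S = drop-mono supermodular (p∩q⊆p T S) (x∈p∩q⁺ (u∈T , u∈S))
  ... | no  u∉S = ≤-reflexive (drop-∉ (u∉S ∘ proj₂ ∘ x∈p∩q⁻ T S))

sumOver : ∀ {n} → Subset n → (Fin n → ℚ) → ℚ
sumOver {n} S x = sumFin n (λ u → if does (u ∈? S) then x u else 0ℚ)

module _ {n} (π : Permutation′ n) where

  ∈-suffix⁺ : ∀ {k u} → k ℕ.≤ toℕ (π ⟨$⟩ˡ u) → u ∈ suffix π k
  ∈-suffix⁺ {k} {u} k≤ = lookup⇒[]= u (suffix π k) (trans (lookup∘tabulate _ u) (Equivalence.to T-≡ (ℕ.≤⇒≤ᵇ k≤)))

  ∈-suffix⁻ : ∀ {k u} → u ∈ suffix π k → k ℕ.≤ toℕ (π ⟨$⟩ˡ u)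
  ∈-suffix⁻ {k} {u} u∈ = ℕ.≤ᵇ⇒≤ k _ (Equivalence.from T-≡ (trans (sym (lookup∘tabulate _ u)) ([]=⇒lookup u∈)))

  ⟨$⟩ʳ∈suffix : ∀ {k i} → π ⟨$⟩ʳ i ∈ suffix π k ⇔ k ℕ.≤ toℕ i
  ⟨$⟩ʳ∈suffix {k} = mk⇔ (λ i∈ → subst (k ℕ.≤_) (cong toℕ (inverseˡ π)) (∈-suffix⁻ i∈))
                        (λ k≤i → ∈-suffix⁺ (subst (k ℕ.≤_) (sym (cong toℕ (inverseˡ π))) k≤i))

  suffix-zero : suffix π 0 ≡ ⊤
  suffix-zero = ⊆-antisym ⊆⊤ (λ _ → ∈-suffix⁺ z≤n)

  suffix-end : suffix π n ≡ ⊥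
  suffix-end = ⊆-antisym (λ u∈ → contradiction (∈-suffix⁻ u∈) (ℕ.<⇒≱ (toℕ<n _))) ⊥⊆

  suffix-suc : ∀ i → suffix π (suc (toℕ i)) ≡ suffix π (toℕ i) ∖ (π ⟨$⟩ʳ i)
  suffix-suc i = ⊆-antisym to from
    where
    to : suffix π (suc (toℕ i)) ⊆ suffix π (toℕ i) ∖ (π ⟨$⟩ʳ i)
    to u∈ = x∈p∧x≢y⇒x∈p-y (∈-suffix⁺ (ℕ.<⇒≤ (∈-suffix⁻ u∈)))
              (λ { refl → ℕ.<-irrefl (cong toℕ (sym (inverseˡ π))) (∈-suffix⁻ u∈) })
    from : suffix π (toℕ i) ∖ (π ⟨$⟩ʳ i) ⊆ suffix π (suc (toℕ i))
    from {u} u∈ = ∈-suffix⁺ (ℕ.≤∧≢⇒< (∈-suffix⁻ (p─q⊆p _ ⁅ π ⟨$⟩ʳ i ⁆ u∈)) i≢)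
      where
      i≢ : toℕ i ≢ toℕ (π ⟨$⟩ˡ u)
      i≢ eq = x∈p-y⇒x≢y u∈ (trans (sym (inverseʳ π)) (cong (π ⟨$⟩ʳ_) (sym (toℕ-injective eq))))

  sumOver-suffix : ∀ (g : Fin n → ℚ) k → sumOver (suffix π k) g ≡ tailSum n (zeroExtend (g ∘ (π ⟨$⟩ʳ_))) k
  sumOver-suffix g k = sumFin-reindex π (λ j → if k ≤ᵇ j then G j else 0ℚ) (λ i →
      cong₂ (λ b y → if b then y else 0ℚ)
            (sym (does-⇔ ⟨$⟩ʳ∈suffix (π ⟨$⟩ʳ i ∈? suffix π k) (k ℕ.≤? toℕ i)))
            (zeroExtend-toℕ (g ∘ (π ⟨$⟩ʳ_)) i))
    where
    G = zeroExtend (g ∘ (π ⟨$⟩ʳ_))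

  module _ (f : SetFn n) where

    orderVector-drop : ∀ i → orderVector f π (π ⟨$⟩ʳ i) ≡ drop f (suffix π (toℕ i)) (π ⟨$⟩ʳ i)
    orderVector-drop i = cong (λ j → drop f (suffix π (toℕ j)) (π ⟨$⟩ʳ i)) (inverseˡ π)

    orderVector-step : ∀ i → orderVector f π (π ⟨$⟩ʳ i) ≡ f (suffix π (toℕ i)) - f (suffix π (suc (toℕ i)))
    orderVector-step i = trans (orderVector-drop i) (cong (λ T → f (suffix π (toℕ i)) - f T) (sym (suffix-suc i)))

    orderVector≤drop⊤ : Supermodular f → ∀ u → orderVector f π u ≤ drop f ⊤ u
    orderVector≤drop⊤ supermodular u = drop-mono f supermodular ⊆⊤ (∈-suffix⁺ ℕ.≤-refl)

record InBase {n} (f : SetFn n) (x : Fin n → ℚ) : Set where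
  field
    nonneg    : ∀ u → 0ℚ ≤ x u
    dominates : ∀ S → f S ≤ sumOver S x
    total     : sumFin n x ≡ f ⊤

module _ {n} {f : SetFn n} (normalized : Normalized f) (π : Permutation′ n) where

  orderVector-total : sumFin n (orderVector f π) ≡ f ⊤
  orderVector-total = begin
    sumFin n (orderVector f π)                                ≡⟨ sumFin-reindex π decrement (sym ∘ orderVector-step π f) ⟩
    sumBelow n decrement                                         ≡⟨ sumBelow-telescope n (f ∘ suffix π) ⟩
    f (suffix π 0) - f (suffix π n)                           ≡⟨ cong₂ (λ S T → f S - f T) (suffix-zero π) (suffix-end π) ⟩
    f ⊤ - f ⊥                                                 ≡⟨ cong (λ z → f ⊤ - z) normalized ⟩
    f ⊤ - 0ℚ                                                  ≡⟨ +-identityʳ (f ⊤) ⟩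
    f ⊤                                                       ∎
    where
    open ≡-Reasoning
    decrement : ℕ → ℚ
    decrement k = f (suffix π k) - f (suffix π (suc k))

  orderVector-dominates : Supermodular f → ∀ S → f S ≤ sumOver S (orderVector f π)
  orderVector-dominates supermodular S = begin
    f S                                      ≡⟨ ends ⟨
    b 0 - b n                                ≡⟨ sumBelow-telescope n b ⟨
    sumBelow n (λ k → b k - b (suc k))       ≤⟨ sumFin-mono n step≤ ⟩
    sumFin n (λ i → if does (π ⟨$⟩ʳ i ∈? S) then orderVector f π (π ⟨$⟩ʳ i) else 0ℚ)
                                             ≡⟨ sumFin-permute n _ π ⟨
    sumOver S (orderVector f π)              ∎
    where
    open ≤-Reasoning
    b : ℕ → ℚ
    b k = f (suffix π k ∩ S)
    ends : b 0 - b n ≡ f S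
    ends = begin-equality
      f (suffix π 0 ∩ S) - f (suffix π n ∩ S) ≡⟨ cong₂ (λ T U → f (T ∩ S) - f (U ∩ S)) (suffix-zero π) (suffix-end π) ⟩
      f (⊤ ∩ S) - f (⊥ ∩ S)                   ≡⟨ cong₂ (λ T U → f T - f U) (∩-identityˡ S) (∩-zeroˡ S) ⟩
      f S - f ⊥                               ≡⟨ cong (λ z → f S - z) normalized ⟩
      f S - 0ℚ                                ≡⟨ +-identityʳ (f S) ⟩
      f S                                     ∎
    step≤ : ∀ i → b (toℕ i) - b (suc (toℕ i)) ≤ (if does (π ⟨$⟩ʳ i ∈? S) then orderVector f π (π ⟨$⟩ʳ i) else 0ℚ)
    step≤ i = begin
      f (T ∩ S) - f (suffix π (suc (toℕ i)) ∩ S) ≡⟨ cong (λ U → f (T ∩ S) - f (U ∩ S)) (suffix-suc π i) ⟩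
      f (T ∩ S) - f ((T ∖ u) ∩ S)                ≡⟨ cong (λ U → f (T ∩ S) - f U) (p-x∩q≡p∩q-x T S u) ⟩
      drop f (T ∩ S) u                           ≤⟨ drop-∩≤ f supermodular S (Equivalence.from (⟨$⟩ʳ∈suffix π) ℕ.≤-refl) ⟩
      (if does (u ∈? S) then drop f T u else 0ℚ) ≡⟨ cong (λ d → if does (u ∈? S) then d else 0ℚ) (orderVector-drop π f i) ⟨
      (if does (u ∈? S) then orderVector f π u else 0ℚ) ∎
      where
      T = suffix π (toℕ i)
      u = π ⟨$⟩ʳ i

  orderVector-inBase : Monotone f → Supermodular f → InBase f (orderVector f π)
  orderVector-inBase monotone supermodular = record
    { nonneg    = λ u → drop-nonneg f monotone _ u
    ; dominates = orderVector-dominates supermodular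
    ; total     = orderVector-total
    }

-- Super-greedy runs

module _ {n} {f : SetFn n} {w : Fin n → ℚ} {σ : Permutation′ n}
         (normalized : Normalized f) (monotone : Monotone f) (supermodular : Supermodular f)
         (run : IsSuperGreedyRun f w σ) where

  private
    W A M : ℕ → ℚ
    W = zeroExtend (w ∘ (σ ⟨$⟩ʳ_))
    A k = f (suffix σ k)
    M = zeroExtend (drop f ⊤ ∘ (σ ⟨$⟩ʳ_))

  superGreedy-weight-drop : ∀ {i j} → toℕ i ℕ.≤ toℕ j → w (σ ⟨$⟩ʳ i) - w (σ ⟨$⟩ʳ j) ≤ drop f ⊤ (σ ⟨$⟩ʳ j)
  superGreedy-weight-drop {i} {j} i≤j = begin
    w u - w v                ≤⟨ p+q≤r+s⇒p-s≤r-q {w u} {drop f V u} {drop f V v} {w v}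
                                  (subst (w u + drop f V u ≤_) (+-comm (w v) (drop f V v)) (run i v v∈V)) ⟩
    drop f V v - drop f V u  ≤⟨ p-q≤p (drop f V v) (drop-nonneg f monotone V u) ⟩
    drop f V v               ≤⟨ drop-mono f supermodular ⊆⊤ v∈V ⟩
    drop f ⊤ v               ∎
    where
    open ≤-Reasoning
    u = σ ⟨$⟩ʳ i
    v = σ ⟨$⟩ʳ j
    V = suffix σ (toℕ i)
    v∈V : v ∈ V
    v∈V = Equivalence.from (⟨$⟩ʳ∈suffix σ) i≤j

  private
    weight-steps : ∀ k → suc k ℕ.< n → W k - W (suc k) ≤ M (suc k)
    weight-steps k 1+k<n = begin
      W k - W (suc k)                  ≡⟨ cong₂ _-_ (zeroExtend-fromℕ< _ k<n) (zeroExtend-fromℕ< _ 1+k<n) ⟩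
      w (σ ⟨$⟩ʳ i) - w (σ ⟨$⟩ʳ j)      ≤⟨ superGreedy-weight-drop i≤j ⟩
      drop f ⊤ (σ ⟨$⟩ʳ j)              ≡⟨ zeroExtend-fromℕ< _ 1+k<n ⟨
      M (suc k)                        ∎
      where
      open ≤-Reasoning
      k<n = ℕ.<-trans (ℕ.n<1+n k) 1+k<n
      i = fromℕ< k<n
      j = fromℕ< 1+k<n
      i≤j : toℕ i ℕ.≤ toℕ j
      i≤j = subst₂ ℕ._≤_ (sym (toℕ-fromℕ< k<n)) (sym (toℕ-fromℕ< 1+k<n)) (ℕ.n≤1+n k)

    value-steps : ∀ j → j ℕ.< n → A j - A (suc j) ≤ M j
    value-steps j j<n = subst (λ k → A k - A (suc k) ≤ M k) (toℕ-fromℕ< j<n) (step (fromℕ< j<n))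
      where
      open ≤-Reasoning
      step : ∀ i → A (toℕ i) - A (suc (toℕ i)) ≤ M (toℕ i)
      step i = begin
        A (toℕ i) - A (suc (toℕ i))  ≡⟨ orderVector-step σ f i ⟨
        orderVector f σ (σ ⟨$⟩ʳ i)   ≤⟨ orderVector≤drop⊤ σ f supermodular _ ⟩
        drop f ⊤ (σ ⟨$⟩ʳ i)          ≡⟨ zeroExtend-toℕ _ i ⟨
        M (toℕ i)                    ∎

  superGreedy-bound : ∀ {x} → InBase f x →
    inner w (orderVector f σ) ≤ inner w x + fromNat n * inner (drop f ⊤) (drop f ⊤)
  superGreedy-bound {x} x∈B = subst₂ _≤_ (sym lhs) (sym rhs)
    (weighted-decrements≤ n W A X M a≤tailSum sumBelow-X (trans (cong f (suffix-end σ)) normalized)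
       (zeroExtend-nonneg (nonneg ∘ (σ ⟨$⟩ʳ_))) (zeroExtend-nonneg (drop-nonneg f monotone ⊤ ∘ (σ ⟨$⟩ʳ_)))
       (zeroExtend-beyond (drop f ⊤ ∘ (σ ⟨$⟩ʳ_)) ℕ.≤-refl) value-steps weight-steps)
    where
    open InBase x∈B
    X = zeroExtend (x ∘ (σ ⟨$⟩ʳ_))

    lhs : inner w (orderVector f σ) ≡ sumBelow n (λ k → W k * (A k - A (suc k)))
    lhs = sumFin-reindex σ (λ k → W k * (A k - A (suc k)))
            (λ i → cong₂ _*_ (zeroExtend-toℕ (w ∘ (σ ⟨$⟩ʳ_)) i) (sym (orderVector-step σ f i)))

    rhs : inner w x + fromNat n * inner (drop f ⊤) (drop f ⊤)
          ≡ sumBelow n (λ k → W k * X k) + fromNat n * sumBelow n (λ k → M k * M k)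
    rhs = cong₂ (λ p q → p + fromNat n * q) (inner-reindex σ w x) (inner-reindex σ (drop f ⊤) (drop f ⊤))

    a≤tailSum : ∀ k → A k ≤ tailSum n X k
    a≤tailSum k = subst (A k ≤_) (sumOver-suffix σ x k) (dominates (suffix σ k))

    sumBelow-X : sumBelow n X ≡ A 0
    sumBelow-X = trans (sym (sumFin-reindex σ X (zeroExtend-toℕ _))) (trans total (cong f (sym (suffix-zero σ))))

lemma6 : (n : ℕ) (f : SetFn n) (w : Fin n → ℚ) →
    Normalized f → NonNegative f → Monotone f → Supermodular f →
    (σ τ : Permutation′ n) → IsSuperGreedyRun f w σ → IsAscendingOrder w τ →
    inner w (orderVector f σ)
      ≤ inner w (orderVector f τ)
        + fromNat n * sumFin n (λ u → drop f ⊤ u * drop f ⊤ u)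
lemma6 n f w normalized _ monotone supermodular σ τ run _ =
  superGreedy-bound {w = w} {σ = σ} normalized monotone supermodular run
    (orderVector-inBase normalized τ monotone supermodular)
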